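{- Let $m$ and $n$ be even positive integers, $n=2n_1$. Define $X=\{x_{i,j}\}$ on the vertices of $\mathcal{K}_{m,n}$ as follows, where $1\le i\le m/2$ throughout: \begin{itemize} \item $x_{2i-1,2j-1}=2m(j-1)+i$ for $1\le j\le\lfloor (n_1+1)/2\rfloor$; \item $x_{2i-1,2j}=2mj+1-i$ for $1\le j\le\lfloor n_1/2\rfloor$; \item $x_{2i-1,2j-1}=m(n+1-2j)+i$ for $\lfloor (n_1+1)/2\rfloor+1\le j\le n_1$; \item $x_{2i-1,2j}=m(n+1-2j)+1-i$ for $\lfloor n_1/2\rfloor+1\le j\le n_1$; \end{itemize} and $x_{2i,j}=mn+1-x_{2i-1,j}$ for $1\le i\le m/2$, $1\le j\le n$. Then $X$ is a $C_4$-face-magic Klein bottle labeling of $\mathcal{K}_{m,n}$.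
   Context: The $m\times n$ Klein bottle grid graph $\mathcal{K}_{m,n}$ has vertex set $\{(i,j):1\le i\le m,\ 1\le j\le n\}$ and edges $(i,j)(i,j+1)$ for $1\le j\le n-1$; $(i,n)(i,1)$; $(i,j)(i+1,j)$ for $1\le i\le m-1$; and $(m,j)(1,n+1-j)$ for $1\le j\le n$. Its $4$-cycle faces in the natural Klein bottle embedding are, with column indices modulo $n$, $\{(i,j),(i,j+1),(i+1,j),(i+1,j+1)\}$ for $1\le i\le m-1$, $1\le j\le n$, and $\{(m,j),(m,j+1),(1,n+1-j),(1,n-j)\}$ for $1\le j\le n$. A $C_4$-face-magic Klein bottle labeling is a bijection $(i,j)\mapsto x_{i,j}$ onto $\{1,\dots,mn\}$ such that the label sum over every such face equals a common constant. -}

module Defs where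

open import Data.Nat using (ℕ; zero; suc; _+_; _*_; _∸_; _≤_; _<_; _≤ᵇ_; _≡ᵇ_)
open import Data.Nat.DivMod using (_/_; _%_)
open import Data.Bool using (Bool; if_then_else_)
open import Data.Product using (Σ; _×_; ∃)
open import Relation.Binary.PropositionalEquality using (_≡_)

-- Vertices of K_{m,n} are (i , j) with 1 ≤ i ≤ m, 1 ≤ j ≤ n (1-based, as in the paper).
-- A labeling is a function ℕ → ℕ → ℕ; only its values on vertices matter.

IsVertex : ℕ → ℕ → ℕ → ℕ → Set
IsVertex m n i j = (1 ≤ i × i ≤ m) × (1 ≤ j × j ≤ n)

IsBijectiveLabeling : ℕ → ℕ → (ℕ → ℕ → ℕ) → Set
IsBijectiveLabeling m n x =
  (∀ i j → IsVertex m n i j → 1 ≤ x i j × x i j ≤ m * n)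
  × (∀ i j i' j' → IsVertex m n i j → IsVertex m n i' j' →
       x i j ≡ x i' j' → i ≡ i' × j ≡ j')
  × (∀ k → 1 ≤ k → k ≤ m * n → ∃ λ i → ∃ λ j → IsVertex m n i j × x i j ≡ k)

-- column index taken modulo n, with representatives 1, …, n  (0 ↦ n, n+1 ↦ 1)
wrap : ℕ → ℕ → ℕ
wrap n c = if c ≡ᵇ 0 then n else (if c ≡ᵇ suc n then 1 else c)

innerFaceSum : ℕ → (ℕ → ℕ → ℕ) → ℕ → ℕ → ℕ
innerFaceSum n x i j =
  x i j + x i (wrap n (suc j)) + x (suc i) j + x (suc i) (wrap n (suc j))

twistFaceSum : ℕ → ℕ → (ℕ → ℕ → ℕ) → ℕ → ℕ
twistFaceSum m n x j =
  x m j + x m (wrap n (suc j)) + x 1 (wrap n (suc n ∸ j)) + x 1 (wrap n (n ∸ j))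

IsC4FaceMagicKleinLabeling : ℕ → ℕ → (ℕ → ℕ → ℕ) → Set
IsC4FaceMagicKleinLabeling m n x =
  IsBijectiveLabeling m n x ×
  ∃ λ k →
    (∀ i j → 1 ≤ i → i < m → 1 ≤ j → j ≤ n → innerFaceSum n x i j ≡ k)
    × (∀ j → 1 ≤ j → j ≤ n → twistFaceSum m n x j ≡ k)

-- The labeling of Proposition 3.5.  Row 2i-1 (index i), column c; n₁ = n / 2.
oddRowLabel : ℕ → ℕ → ℕ → ℕ → ℕ
oddRowLabel m n i c =
  if c % 2 ≡ᵇ 1
  then (let j = (c + 1) / 2 in
        if j ≤ᵇ (n / 2 + 1) / 2
        then 2 * m * (j ∸ 1) + i
        else m * (n + 1 ∸ 2 * j) + i)
  else (let j = c / 2 in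
        if j ≤ᵇ (n / 2) / 2
        then (2 * m * j + 1) ∸ i
        else (m * (n + 1 ∸ 2 * j) + 1) ∸ i)

label : ℕ → ℕ → ℕ → ℕ → ℕ
label m n r c =
  if r % 2 ≡ᵇ 1
  then oddRowLabel m n ((r + 1) / 2) c
  else (m * n + 1) ∸ oddRowLabel m n (r / 2) c

-- On the odd row 2i − 1 the label in column c is m·β(c) + τ + 1, with block β(c) = min(c − 1, n − c)
-- and offset τ = i − 1 in odd and m − i in even columns.  The two columns sharing a block have
-- opposite parities, and odd offsets stay below m/2 ≤ even ones, so (β, τ) determines the cell:
-- the odd rows carry 1, …, mn/2 bijectively and the even rows, holding mn + 1 − x, carry the rest.
-- Adjacent columns have opposite parities, so in any odd row their offsets add up to m − 1 and the
-- sum of their two labels does not depend on the row.  Hence a face between rows 2i − 1 and 2i sums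
-- to 2(mn + 1) by complementation, a face between rows 2i and 2i + 1 does as well because both odd
-- rows have the same pair sum, and so does a twisted face, because β(n + 1 − c) = β(c) gives the
-- mirrored pair in row 1 the same sum as the pair in row m − 1.

module Submission where

open import Defs
open import Data.Nat using (ℕ; _<_)
open import Data.Nat.Base using (zero; suc; pred; _+_; _*_; _∸_; _⊓_; _≤_; _≤ᵇ_; _≡ᵇ_; z≤n; s≤s; NonZero; parity)
open import Data.Nat.Properties
open import Data.Nat.DivMod using (_/_; _%_; m*n/n≡m; m/n*n≤m; /-monoˡ-≤; [m+kn]%n≡m%n; m*n%n≡0; m%n<n; m<n⇒m%n≡m; m≡m%n+[m/n]*n; m<n*o⇒m/o<n)
open import Data.Nat.Divisibility using (_∣_; divides)
open import Data.Nat.Tactic.RingSolver using (solve-∀)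
open import Algebra.Properties.CommutativeSemigroup +-commutativeSemigroup using (interchange)
open import Data.Parity.Base using (Parity; 0ℙ; 1ℙ; _⁻¹)
open import Data.Parity.Properties using (+-homo-+; suc-homo-⁻¹; ⁻¹-selfInverse; p≢p⁻¹)
open import Data.Bool.Base using (true; false; T)
open import Data.Empty using (⊥-elim)
open import Data.Product using (_×_; ∃; ∃₂; _,_; proj₁; proj₂)
open import Data.Sum using (_⊎_; inj₁; inj₂)
open import Relation.Nullary using (contradiction; yes; no)
open import Relation.Nullary.Reflects using (ofʸ; ofⁿ; det; fromEquivalence)
open import Relation.Binary.PropositionalEquality

data ParityView : ℕ → Set where
  odd  : ∀ h → ParityView (suc (h * 2))
  even : ∀ h → ParityView (h * 2)

parityView : ∀ c → ParityView c
parityView zero = even 0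
parityView (suc c) with parityView c
... | odd h = even (suc h)
... | even h = odd h

parity[h*2]≡0ℙ : ∀ h → parity (h * 2) ≡ 0ℙ
parity[h*2]≡0ℙ zero = refl
parity[h*2]≡0ℙ (suc h) = parity[h*2]≡0ℙ h

parity[1+h*2]≡1ℙ : ∀ h → parity (suc (h * 2)) ≡ 1ℙ
parity[1+h*2]≡1ℙ zero = refl
parity[1+h*2]≡1ℙ (suc h) = parity[1+h*2]≡1ℙ h

parity-dichotomy : ∀ p q → p ≡ q ⊎ p ≡ q ⁻¹
parity-dichotomy 0ℙ 0ℙ = inj₁ refl
parity-dichotomy 0ℙ 1ℙ = inj₂ refl
parity-dichotomy 1ℙ 0ℙ = inj₂ refl
parity-dichotomy 1ℙ 1ℙ = inj₁ refl

parity-complement : ∀ {x y h} → x + y ≡ suc (h * 2) → parity x ≡ parity y ⁻¹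
parity-complement {x} {y} {h} x+y≡odd
  with parity x | parity y | trans (sym (+-homo-+ x y)) (trans (cong parity x+y≡odd) (parity[1+h*2]≡1ℙ h))
... | 0ℙ | 1ℙ | _ = refl
... | 1ℙ | 0ℙ | _ = refl

*2≤⇒≤/2 : ∀ {k x} → k * 2 ≤ x → k ≤ x / 2
*2≤⇒≤/2 {k} {x} le = subst (_≤ x / 2) (m*n/n≡m k 2) (/-monoˡ-≤ 2 le)

≤/2⇒*2≤ : ∀ {k x} → k ≤ x / 2 → k * 2 ≤ x
≤/2⇒*2≤ {k} {x} le = ≤-trans (*-monoˡ-≤ 2 le) (m/n*n≤m x 2)

≤ᵇ-/2 : ∀ k x → (k ≤ᵇ x / 2) ≡ (k * 2 ≤ᵇ x)
≤ᵇ-/2 k x = det (≤ᵇ-reflects-≤ k (x / 2))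
  (fromEquivalence (λ t → *2≤⇒≤/2 (≤ᵇ⇒≤ (k * 2) x t)) (λ le → ≤⇒≤ᵇ (≤/2⇒*2≤ le)))

≤ᵇ-[+1]/2 : ∀ h x → (suc h ≤ᵇ (x + 1) / 2) ≡ (suc (h * 2) ≤ᵇ x)
≤ᵇ-[+1]/2 h x = trans (≤ᵇ-/2 (suc h) (x + 1)) (cong (suc h * 2 ≤ᵇ_) (+-comm x 1))

m*q+[1+r]≡1+[r+q*m] : ∀ m q r → m * q + suc r ≡ suc (r + q * m)
m*q+[1+r]≡1+[r+q*m] = solve-∀

*+suc-injective : ∀ m .{{_ : NonZero m}} {B B′ T T′} → T < m → T′ < m →
                  m * B + suc T ≡ m * B′ + suc T′ → B ≡ B′ × T ≡ T′
*+suc-injective m {B} {B′} {T} {T′} T<m T′<m eq = B≡B′ , T≡T′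
  where
  open ≡-Reasoning
  eq′ : T + B * m ≡ T′ + B′ * m
  eq′ = suc-injective (trans (sym (m*q+[1+r]≡1+[r+q*m] m B T)) (trans eq (m*q+[1+r]≡1+[r+q*m] m B′ T′)))
  T≡T′ : T ≡ T′
  T≡T′ = begin
    T                  ≡⟨ sym (m<n⇒m%n≡m T<m) ⟩
    T % m              ≡⟨ sym ([m+kn]%n≡m%n T B m) ⟩
    (T + B * m) % m    ≡⟨ cong (_% m) eq′ ⟩
    (T′ + B′ * m) % m  ≡⟨ [m+kn]%n≡m%n T′ B′ m ⟩
    T′ % m             ≡⟨ m<n⇒m%n≡m T′<m ⟩
    T′                 ∎
  B≡B′ : B ≡ B′
  B≡B′ = *-cancelʳ-≡ B B′ m (+-cancelˡ-≡ T _ _ (trans eq′ (cong (_+ B′ * m) (sym T≡T′))))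

*+suc-surjective : ∀ m .{{_ : NonZero m}} {b k} → 1 ≤ k → k ≤ m * b →
                   ∃₂ λ B T → B < b × T < m × m * B + suc T ≡ k
*+suc-surjective m {b} {suc k} _ k<mb =
  k / m , k % m , m<n*o⇒m/o<n (subst (k <_) (*-comm m b) k<mb) , m%n<n k m ,
  trans (m*q+[1+r]≡1+[r+q*m] m (k / m) (k % m)) (cong suc (sym (m≡m%n+[m/n]*n k m)))

*+suc≤ : ∀ m {b B T} → B < b → T < m → m * B + suc T ≤ m * b
*+suc≤ m {b} {B} {T} B<b T<m = begin
  m * B + suc T  ≤⟨ +-monoʳ-≤ (m * B) T<m ⟩
  m * B + m      ≡⟨ +-comm (m * B) m ⟩
  m + m * B      ≡⟨ sym (*-suc m B) ⟩
  m * suc B      ≤⟨ *-monoʳ-≤ m B<b ⟩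
  m * b          ∎
  where open ≤-Reasoning

m*[1+d]+1∸o≡m*d+[1+m∸o] : ∀ m d {o} → o ≤ m → m * suc d + 1 ∸ o ≡ m * d + suc (m ∸ o)
m*[1+d]+1∸o≡m*d+[1+m∸o] m d {o} o≤m = begin
  m * suc d + 1 ∸ o    ≡⟨ cong (_∸ o) (expand m d) ⟩
  m * d + suc m ∸ o    ≡⟨ +-∸-assoc (m * d) (m≤n⇒m≤1+n o≤m) ⟩
  m * d + (suc m ∸ o)  ≡⟨ cong (m * d +_) (+-∸-assoc 1 o≤m) ⟩
  m * d + suc (m ∸ o)  ∎
  where
  open ≡-Reasoning
  expand : ∀ m d → m * suc d + 1 ≡ m * d + suc m
  expand = solve-∀

k*2≡k+k : ∀ k → k * 2 ≡ k + k
k*2≡k+k = solve-∀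

k*2∸k≡k : ∀ k → k * 2 ∸ k ≡ k
k*2∸k≡k k = trans (cong (_∸ k) (k*2≡k+k k)) (m+n∸m≡n k k)

2*m*j≡m*[j*2] : ∀ m j → 2 * m * j ≡ m * (j * 2)
2*m*j≡m*[j*2] = solve-∀

digits-+ : ∀ m B B′ T T′ → (m * B + suc T) + (m * B′ + suc T′) ≡ m * (B + B′) + suc (suc (T + T′))
digits-+ = solve-∀

complements+pair≡N+N : ∀ {N u v x y} → u ≤ N → v ≤ N → x + y ≡ u + v → N ∸ u + (N ∸ v) + x + y ≡ N + N
complements+pair≡N+N {N} {u} {v} {x} {y} u≤N v≤N x+y≡u+v = begin
  N ∸ u + (N ∸ v) + x + y      ≡⟨ +-assoc (N ∸ u + (N ∸ v)) x y ⟩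
  N ∸ u + (N ∸ v) + (x + y)    ≡⟨ cong (N ∸ u + (N ∸ v) +_) x+y≡u+v ⟩
  N ∸ u + (N ∸ v) + (u + v)    ≡⟨ interchange (N ∸ u) (N ∸ v) u v ⟩
  (N ∸ u + u) + (N ∸ v + v)    ≡⟨ cong₂ _+_ (m∸n+n≡m u≤N) (m∸n+n≡m v≤N) ⟩
  N + N                        ∎
  where open ≡-Reasoning

pair+complements≡N+N : ∀ {N u v} → u ≤ N → v ≤ N → u + v + (N ∸ u) + (N ∸ v) ≡ N + N
pair+complements≡N+N {N} {u} {v} u≤N v≤N = begin
  u + v + (N ∸ u) + (N ∸ v)  ≡⟨ +-assoc (u + v) (N ∸ u) (N ∸ v) ⟩
  u + v + (N ∸ u + (N ∸ v))  ≡⟨ +-comm (u + v) (N ∸ u + (N ∸ v)) ⟩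
  N ∸ u + (N ∸ v) + (u + v)  ≡⟨ sym (+-assoc (N ∸ u + (N ∸ v)) u v) ⟩
  N ∸ u + (N ∸ v) + u + v    ≡⟨ complements+pair≡N+N u≤N v≤N refl ⟩
  N + N                      ∎
  where open ≡-Reasoning

wrap-inRange : ∀ {n x} → 1 ≤ x → x ≤ n → wrap n x ≡ x
wrap-inRange {n} {suc y} _ y<n with y ≡ᵇ n in y≡ᵇn
... | false = refl
... | true  = contradiction (≡ᵇ⇒≡ y n (subst T (sym y≡ᵇn) _)) (<⇒≢ y<n)

wrap-suc : ∀ n → wrap n (suc n) ≡ 1
wrap-suc n with n ≡ᵇ n in n≡ᵇn
... | true  = refl
... | false = ⊥-elim (subst T n≡ᵇn (≡⇒≡ᵇ n n refl))

[1+h*2]%2≡1 : ∀ h → suc (h * 2) % 2 ≡ 1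
[1+h*2]%2≡1 h = [m+kn]%n≡m%n 1 h 2

[h*2]%2≡0 : ∀ h → (h * 2) % 2 ≡ 0
[h*2]%2≡0 h = m*n%n≡0 h 2

[h*2]/2≡h : ∀ h → (h * 2) / 2 ≡ h
[h*2]/2≡h h = m*n/n≡m h 2

[1+h*2+1]/2≡1+h : ∀ h → (suc (h * 2) + 1) / 2 ≡ suc h
[1+h*2+1]/2≡1+h h = trans (cong (_/ 2) (+-comm (suc (h * 2)) 1)) ([h*2]/2≡h (suc h))

label-upper : ∀ m n h c → label m n (suc (h * 2)) c ≡ oddRowLabel m n (suc h) c
label-upper m n h c rewrite [1+h*2]%2≡1 h | [1+h*2+1]/2≡1+h h = refl

label-lower : ∀ m n h c → label m n (suc h * 2) c ≡ m * n + 1 ∸ oddRowLabel m n (suc h) c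
label-lower m n h c rewrite [h*2]%2≡0 (suc h) | [h*2]/2≡h (suc h) = refl

data RowPosition (k : ℕ) : ℕ → Set where
  upper : ∀ h → suc h ≤ k → RowPosition k (suc (h * 2))
  lower : ∀ h → suc h ≤ k → RowPosition k (suc h * 2)

rowPosition : ∀ {k r} → 1 ≤ r → r ≤ k * 2 → RowPosition k r
rowPosition {k} {r} 1≤r r≤2k with parityView r
... | odd h        = upper h (*-cancelʳ-< 2 h k r≤2k)
... | even (suc h) = lower h (*-cancelʳ-≤ (suc h) k 2 r≤2k)

module Construction (m′ n₁ : ℕ) where

  m₁ m n N M : ℕ
  m₁ = suc m′
  m = m₁ * 2
  n = n₁ * 2
  N = m * n + 1
  M = m * n₁

  -- OddRow i: i indexes the odd row 2i − 1.
  OddRow Column : ℕ → Set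
  OddRow i = 1 ≤ i × i ≤ m₁
  Column c = 1 ≤ c × c ≤ n

  oddRow : ∀ {h} → suc h ≤ m₁ → OddRow (suc h)
  oddRow h<m₁ = s≤s z≤n , h<m₁

  OppositeColumns : ℕ → ℕ → Set
  OppositeColumns c c′ = Column c × Column c′ × parity c′ ≡ parity c ⁻¹

  -- block merges the paper's cases c ≤ n₁ (c − 1) and c > n₁ (n − c) into a minimum,
  -- which makes block-mirror an instance of ⊓-comm.
  next mirror block : ℕ → ℕ
  next c = wrap n (suc c)
  mirror c = suc n ∸ c
  block c = pred c ⊓ (n ∸ c)

  offsetBy : Parity → ℕ → ℕ
  offsetBy 1ℙ i = pred i
  offsetBy 0ℙ i = m ∸ i

  offset oddLabel : ℕ → ℕ → ℕ
  offset i c = offsetBy (parity c) i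
  oddLabel = oddRowLabel m n

  n₁≤n : n₁ ≤ n
  n₁≤n = m≤m*n n₁ 2

  m₁≤m : m₁ ≤ m
  m₁≤m = m≤m*n m₁ 2

  mn≡M+M : m * n ≡ M + M
  mn≡M+M = trans (cong (m *_) (k*2≡k+k n₁)) (*-distribˡ-+ m n₁ n₁)

  M≤mn : M ≤ m * n
  M≤mn = subst (M ≤_) (sym mn≡M+M) (m≤m+n M M)

  N≡M+[1+M] : N ≡ M + suc M
  N≡M+[1+M] = begin
    m * n + 1      ≡⟨ cong (_+ 1) mn≡M+M ⟩
    M + M + 1      ≡⟨ +-assoc M M 1 ⟩
    M + (M + 1)    ≡⟨ cong (M +_) (+-comm M 1) ⟩
    M + suc M      ∎
    where open ≡-Reasoning

  mn<N : m * n < N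
  mn<N = subst (m * n <_) (+-comm 1 (m * n)) ≤-refl

  mirror≡1+n∸ : ∀ {c} → c ≤ n → mirror c ≡ suc (n ∸ c)
  mirror≡1+n∸ = +-∸-assoc 1

  mirror-column : ∀ {c} → Column c → Column (mirror c)
  mirror-column {suc k} (_ , c≤n) = subst (1 ≤_) (sym (mirror≡1+n∸ c≤n)) (s≤s z≤n) , m∸n≤m n k

  parity-mirror : ∀ {c} → Column c → parity (mirror c) ≡ parity c ⁻¹
  parity-mirror {c} (_ , c≤n) = parity-complement {mirror c} {c} {n₁} (m∸n+n≡m (m≤n⇒m≤1+n c≤n))

  next-column : ∀ {c} → Column c → Column (next c)
  next-column {c} (1≤c , c≤n) with m≤n⇒m<n∨m≡n c≤n
  ... | inj₁ c<n  rewrite wrap-inRange (s≤s z≤n) c<n = s≤s z≤n , c<n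
  ... | inj₂ refl rewrite wrap-suc n = s≤s z≤n , 1≤c

  parity-next : ∀ {c} → Column c → parity (next c) ≡ parity c ⁻¹
  parity-next {c} (1≤c , c≤n) with m≤n⇒m<n∨m≡n c≤n
  ... | inj₁ c<n  rewrite wrap-inRange (s≤s z≤n) c<n = sym (⁻¹-selfInverse (suc-homo-⁻¹ c))
  ... | inj₂ refl rewrite wrap-suc n | parity[h*2]≡0ℙ n₁ = refl

  next-opposite : ∀ {c} → Column c → OppositeColumns c (next c)
  next-opposite col = col , next-column col , parity-next col

  mirror-opposite : ∀ {c c′} → OppositeColumns c c′ → OppositeColumns (mirror c) (mirror c′)
  mirror-opposite {c} {c′} (col , col′ , opp) = mirror-column col , mirror-column col′ , (begin
    parity (mirror c′)    ≡⟨ parity-mirror col′ ⟩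
    parity c′ ⁻¹          ≡⟨ cong _⁻¹ opp ⟩
    parity c ⁻¹ ⁻¹        ≡⟨ cong _⁻¹ (sym (parity-mirror col)) ⟩
    parity (mirror c) ⁻¹  ∎)
    where open ≡-Reasoning

  wrap-mirror : ∀ {c} → Column c → wrap n (mirror c) ≡ mirror c
  wrap-mirror col = let (1≤c̄ , c̄≤n) = mirror-column col in wrap-inRange 1≤c̄ c̄≤n

  wrap-n∸ : ∀ {c} → Column c → wrap n (n ∸ c) ≡ mirror (next c)
  wrap-n∸ {c} (1≤c , c≤n) with m≤n⇒m<n∨m≡n c≤n
  ... | inj₁ c<n  rewrite wrap-inRange (s≤s z≤n) c<n = wrap-inRange (m<n⇒0<n∸m c<n) (m∸n≤m n c)
  ... | inj₂ refl rewrite wrap-suc n | n∸n≡0 n = refl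

  block-low : ∀ {c} → 1 ≤ c → c ≤ n₁ → block c ≡ pred c
  block-low {suc k} _ c≤n₁ = m≤n⇒m⊓n≡m (m+n≤o⇒m≤o∸n k
    (subst (k + suc k ≤_) (sym (k*2≡k+k n₁)) (+-mono-≤ (<⇒≤ c≤n₁) c≤n₁)))

  block-high : ∀ {c} → n₁ < c → block c ≡ n ∸ c
  block-high {suc k} (s≤s n₁≤k) = m≥n⇒m⊓n≡n (m≤n+o⇒m∸n≤o n (suc k)
    (subst (_≤ suc k + k) (sym (k*2≡k+k n₁)) (+-mono-≤ (m≤n⇒m≤1+n n₁≤k) n₁≤k)))

  block-mirror : ∀ {c} → Column c → block (mirror c) ≡ block c
  block-mirror {suc k} (_ , c≤n) = begin
    pred (n ∸ k) ⊓ (n ∸ (n ∸ k))  ≡⟨ cong₂ _⊓_ (pred[m∸n]≡m∸[1+n] n k) (m∸[m∸n]≡n (<⇒≤ c≤n)) ⟩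
    (n ∸ suc k) ⊓ k               ≡⟨ ⊓-comm (n ∸ suc k) k ⟩
    k ⊓ (n ∸ suc k)               ∎
    where open ≡-Reasoning

  block-< : ∀ {c} → Column c → block c < n₁
  block-< {suc k} (_ , c≤n) with suc k ≤? n₁
  ... | yes c≤n₁ rewrite block-low (s≤s z≤n) c≤n₁ = c≤n₁
  ... | no c≰n₁  rewrite block-high (≰⇒> c≰n₁) =
    subst (n ∸ suc k <_) (k*2∸k≡k n₁) (∸-monoʳ-< (≰⇒> c≰n₁) c≤n)

  ≢mirror : ∀ {c c′} → Column c′ → parity c ≡ parity c′ → c ≢ mirror c′
  ≢mirror col′ same refl = p≢p⁻¹ _ (trans (sym same) (parity-mirror col′))

  pred≡n∸⇒≡mirror : ∀ {c c′} → 1 ≤ c → c′ ≤ n → pred c ≡ n ∸ c′ → c ≡ mirror c′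
  pred≡n∸⇒≡mirror {suc k} _ c′≤n k≡n∸c′ = sym (trans (mirror≡1+n∸ c′≤n) (cong suc (sym k≡n∸c′)))

  block-injective : ∀ {c c′} → Column c → Column c′ → parity c ≡ parity c′ → block c ≡ block c′ → c ≡ c′
  block-injective {suc k} {suc k′} col@(1≤c , c≤n) col′@(1≤c′ , c′≤n) same eq
    with ⊓-sel k (n ∸ suc k) | ⊓-sel k′ (n ∸ suc k′)
  ... | inj₁ b≡k  | inj₁ b′≡k′ = cong suc (trans (sym b≡k) (trans eq b′≡k′))
  ... | inj₂ b≡n∸ | inj₂ b′≡n∸ = ∸-cancelˡ-≡ c≤n c′≤n (trans (sym b≡n∸) (trans eq b′≡n∸))
  ... | inj₁ b≡k  | inj₂ b′≡n∸ =
    contradiction (pred≡n∸⇒≡mirror 1≤c c′≤n (trans (sym b≡k) (trans eq b′≡n∸))) (≢mirror col′ same)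
  ... | inj₂ b≡n∸ | inj₁ b′≡k′ =
    contradiction (pred≡n∸⇒≡mirror 1≤c′ c≤n (trans (sym b′≡k′) (trans (sym eq) b≡n∸))) (≢mirror col (sym same))

  low-column : ∀ {B} → B < n₁ → Column (suc B)
  low-column B<n₁ = s≤s z≤n , ≤-trans B<n₁ n₁≤n

  column-with-block : ∀ {B} → B < n₁ → ∀ p → ∃ λ c → Column c × block c ≡ B × parity c ≡ p
  column-with-block {B} B<n₁ p with parity-dichotomy p (parity (suc B))
  ... | inj₁ p≡ = suc B , low-column B<n₁ , block-low (s≤s z≤n) B<n₁ , sym p≡
  ... | inj₂ p≡ = mirror (suc B) , mirror-column (low-column B<n₁) ,
    trans (block-mirror (low-column B<n₁)) (block-low (s≤s z≤n) B<n₁) ,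
    trans (parity-mirror (low-column B<n₁)) (sym p≡)

  offsetBy-< : ∀ p {i} → OddRow i → offsetBy p i < m
  offsetBy-< 1ℙ {suc i} (_ , i<m₁) = ≤-trans i<m₁ m₁≤m
  offsetBy-< 0ℙ {suc i} _ = s≤s (m∸n≤m (suc (m′ * 2)) i)

  odd-offset<even-offset : ∀ {i i′} → OddRow i → OddRow i′ → offsetBy 1ℙ i < offsetBy 0ℙ i′
  odd-offset<even-offset {suc i} {i′} (_ , i<m₁) (_ , i′≤m₁) =
    ≤-trans i<m₁ (subst (_≤ m ∸ i′) (k*2∸k≡k m₁) (∸-monoʳ-≤ m i′≤m₁))

  offsetBy-injective : ∀ p q {i i′} → OddRow i → OddRow i′ → offsetBy p i ≡ offsetBy q i′ → p ≡ q × i ≡ i′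
  offsetBy-injective 1ℙ 1ℙ {suc i} {suc i′} _ _ eq = refl , cong suc eq
  offsetBy-injective 0ℙ 0ℙ (_ , i≤m₁) (_ , i′≤m₁) eq = refl , ∸-cancelˡ-≡ (≤-trans i≤m₁ m₁≤m) (≤-trans i′≤m₁ m₁≤m) eq
  offsetBy-injective 1ℙ 0ℙ row row′ eq = contradiction eq (<⇒≢ (odd-offset<even-offset row row′))
  offsetBy-injective 0ℙ 1ℙ row row′ eq = contradiction (sym eq) (<⇒≢ (odd-offset<even-offset row′ row))

  offsetBy-surjective : ∀ {T} → T < m → ∃₂ λ p i → OddRow i × offsetBy p i ≡ T
  offsetBy-surjective {T} T<m with T <? m₁
  ... | yes T<m₁ = 1ℙ , suc T , (s≤s z≤n , T<m₁) , refl
  ... | no T≮m₁  = 0ℙ , m ∸ T ,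
    (m<n⇒0<n∸m T<m , subst (m ∸ T ≤_) (k*2∸k≡k m₁) (∸-monoʳ-≤ m (≮⇒≥ T≮m₁))) , m∸[m∸n]≡n (<⇒≤ T<m)

  pred[i]+[m∸i]≡pred[m] : ∀ {i} → OddRow i → pred i + (m ∸ i) ≡ pred m
  pred[i]+[m∸i]≡pred[m] {suc i} (_ , i≤m₁) = cong pred (m+[n∸m]≡n (≤-trans i≤m₁ m₁≤m))

  offsetBy-complement : ∀ p {i} → OddRow i → offsetBy p i + offsetBy (p ⁻¹) i ≡ pred m
  offsetBy-complement 1ℙ row = pred[i]+[m∸i]≡pred[m] row
  offsetBy-complement 0ℙ {i} row = trans (+-comm (m ∸ i) (pred i)) (pred[i]+[m∸i]≡pred[m] row)

  n+1∸2*j≡mirror[j*2] : ∀ j → n + 1 ∸ 2 * j ≡ mirror (j * 2)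
  n+1∸2*j≡mirror[j*2] j = cong₂ _∸_ (+-comm n 1) (*-comm 2 j)

  oddLabel-digits : ∀ {i c} → OddRow i → Column c → oddLabel i c ≡ m * block c + suc (offset i c)
  oddLabel-digits {suc i} {c} (_ , i<m₁) (1≤c , c≤n) with parityView c
  ... | odd h
      rewrite [1+h*2]%2≡1 h | [1+h*2+1]/2≡1+h h | [h*2]/2≡h n₁ | ≤ᵇ-[+1]/2 h n₁ | parity[1+h*2]≡1ℙ h
      with suc (h * 2) ≤ᵇ n₁ | ≤ᵇ-reflects-≤ (suc (h * 2)) n₁
  ...   | true  | ofʸ c≤n₁ rewrite block-low 1≤c c≤n₁ = cong (_+ suc i) (2*m*j≡m*[j*2] m h)
  ...   | false | ofⁿ c≰n₁ rewrite block-high (≰⇒> c≰n₁) =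
    cong (λ z → m * z + suc i) (n+1∸2*j≡mirror[j*2] (suc h))
  oddLabel-digits {suc i} {c} (_ , i<m₁) (1≤c , c≤n) | even (suc h)
      rewrite [h*2]%2≡0 (suc h) | [h*2]/2≡h (suc h) | [h*2]/2≡h n₁ | ≤ᵇ-/2 (suc h) n₁ | parity[h*2]≡0ℙ (suc h)
      with suc h * 2 ≤ᵇ n₁ | ≤ᵇ-reflects-≤ (suc h * 2) n₁
  ...   | true  | ofʸ c≤n₁ rewrite block-low 1≤c c≤n₁ =
    trans (cong (λ z → z + 1 ∸ suc i) (2*m*j≡m*[j*2] m (suc h)))
          (m*[1+d]+1∸o≡m*d+[1+m∸o] m (suc (h * 2)) (≤-trans i<m₁ m₁≤m))
  ...   | false | ofⁿ c≰n₁ rewrite block-high (≰⇒> c≰n₁) =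
    trans (cong (λ z → m * z + 1 ∸ suc i) (trans (n+1∸2*j≡mirror[j*2] (suc h)) (mirror≡1+n∸ c≤n)))
          (m*[1+d]+1∸o≡m*d+[1+m∸o] m (n ∸ c) (≤-trans i<m₁ m₁≤m))

  oddLabel-bounds : ∀ {i c} → OddRow i → Column c → 1 ≤ oddLabel i c × oddLabel i c ≤ M
  oddLabel-bounds {i} {c} row col rewrite oddLabel-digits row col =
    ≤-trans (s≤s z≤n) (m≤n+m (suc (offset i c)) (m * block c)) ,
    *+suc≤ m (block-< col) (offsetBy-< (parity c) row)

  oddLabel-injective : ∀ {i c i′ c′} → OddRow i → Column c → OddRow i′ → Column c′ →
                       oddLabel i c ≡ oddLabel i′ c′ → i ≡ i′ × c ≡ c′
  oddLabel-injective {i} {c} {i′} {c′} row col row′ col′ eq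
    with *+suc-injective m (offsetBy-< (parity c) row) (offsetBy-< (parity c′) row′)
           (trans (sym (oddLabel-digits row col)) (trans eq (oddLabel-digits row′ col′)))
  ... | same-block , same-offset with offsetBy-injective (parity c) (parity c′) row row′ same-offset
  ... | same-parity , i≡i′ = i≡i′ , block-injective col col′ same-parity same-block

  oddLabel-surjective : ∀ {k} → 1 ≤ k → k ≤ M → ∃₂ λ i c → OddRow i × Column c × oddLabel i c ≡ k
  oddLabel-surjective {k} 1≤k k≤M with *+suc-surjective m 1≤k k≤M
  ... | B , T , B<n₁ , T<m , digits≡k with offsetBy-surjective T<m
  ... | p , i , row , offset≡T with column-with-block B<n₁ p
  ... | c , col , block≡B , parity≡p = i , c , row , col , (begin
    oddLabel i c                               ≡⟨ oddLabel-digits row col ⟩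
    m * block c + suc (offsetBy (parity c) i)  ≡⟨ cong₂ (λ B′ p′ → m * B′ + suc (offsetBy p′ i)) block≡B parity≡p ⟩
    m * B + suc (offsetBy p i)                 ≡⟨ cong (λ T′ → m * B + suc T′) offset≡T ⟩
    m * B + suc T                              ≡⟨ digits≡k ⟩
    k                                          ∎)
    where open ≡-Reasoning

  oddLabel-pair : ∀ {i c c′} → OddRow i → OppositeColumns c c′ →
                  oddLabel i c + oddLabel i c′ ≡ m * (block c + block c′) + suc m
  oddLabel-pair {i} {c} {c′} row (col , col′ , opp) = begin
    oddLabel i c + oddLabel i c′
      ≡⟨ cong₂ _+_ (oddLabel-digits row col) (oddLabel-digits row col′) ⟩
    (m * block c + suc (offset i c)) + (m * block c′ + suc (offset i c′))
      ≡⟨ digits-+ m (block c) (block c′) (offset i c) (offset i c′) ⟩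
    m * (block c + block c′) + suc (suc (offset i c + offset i c′))
      ≡⟨ cong (λ p → m * (block c + block c′) + suc (suc (offset i c + offsetBy p i))) opp ⟩
    m * (block c + block c′) + suc (suc (offset i c + offsetBy (parity c ⁻¹) i))
      ≡⟨ cong (λ T → m * (block c + block c′) + suc (suc T)) (offsetBy-complement (parity c) row) ⟩
    m * (block c + block c′) + suc m
      ∎
    where open ≡-Reasoning

  oddLabel-≤N : ∀ {i c} → OddRow i → Column c → oddLabel i c ≤ N
  oddLabel-≤N row col = ≤-trans (proj₂ (oddLabel-bounds row col)) (≤-trans M≤mn (m≤m+n (m * n) 1))

  complement-bounds : ∀ {x} → 1 ≤ x → x ≤ M → M < N ∸ x × N ∸ x ≤ m * n
  complement-bounds {x} 1≤x x≤M =
    subst (_≤ N ∸ x) (trans (cong (_∸ M) N≡M+[1+M]) (m+n∸m≡n M (suc M))) (∸-monoʳ-≤ N x≤M) ,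
    subst (N ∸ x ≤_) (m+n∸n≡m (m * n) 1) (∸-monoʳ-≤ N 1≤x)

  upper<lower : ∀ {i c i′ c′} → OddRow i → Column c → OddRow i′ → Column c′ → oddLabel i c < N ∸ oddLabel i′ c′
  upper<lower row col row′ col′ =
    let (1≤x′ , x′≤M) = oddLabel-bounds row′ col′
    in ≤-trans (s≤s (proj₂ (oddLabel-bounds row col))) (proj₁ (complement-bounds 1≤x′ x′≤M))

  label-range : ∀ r c → IsVertex m n r c → 1 ≤ label m n r c × label m n r c ≤ m * n
  label-range r c ((1≤r , r≤m) , col) with rowPosition {m₁} 1≤r r≤m
  ... | upper h h<m₁ rewrite label-upper m n h c =
    let (1≤x , x≤M) = oddLabel-bounds (oddRow h<m₁) col in 1≤x , ≤-trans x≤M M≤mn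
  ... | lower h h<m₁ rewrite label-lower m n h c =
    let (1≤x , x≤M) = oddLabel-bounds (oddRow h<m₁) col
        (M<y , y≤mn) = complement-bounds 1≤x x≤M
    in ≤-trans (s≤s z≤n) M<y , y≤mn

  label-injective : ∀ r c r′ c′ → IsVertex m n r c → IsVertex m n r′ c′ →
                    label m n r c ≡ label m n r′ c′ → r ≡ r′ × c ≡ c′
  label-injective r c r′ c′ ((1≤r , r≤m) , col) ((1≤r′ , r′≤m) , col′) eq
    with rowPosition {m₁} 1≤r r≤m | rowPosition {m₁} 1≤r′ r′≤m
  ... | upper h h<m₁ | upper h′ h′<m₁ =
    let (i≡i′ , c≡c′) = oddLabel-injective (oddRow h<m₁) col (oddRow h′<m₁) col′
                          (trans (sym (label-upper m n h c)) (trans eq (label-upper m n h′ c′)))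
    in cong (λ i → suc (pred i * 2)) i≡i′ , c≡c′
  ... | lower h h<m₁ | lower h′ h′<m₁ =
    let (i≡i′ , c≡c′) = oddLabel-injective (oddRow h<m₁) col (oddRow h′<m₁) col′
                          (∸-cancelˡ-≡ (oddLabel-≤N (oddRow h<m₁) col) (oddLabel-≤N (oddRow h′<m₁) col′)
                            (trans (sym (label-lower m n h c)) (trans eq (label-lower m n h′ c′))))
    in cong (_* 2) i≡i′ , c≡c′
  ... | upper h h<m₁ | lower h′ h′<m₁ =
    contradiction (trans (sym (label-upper m n h c)) (trans eq (label-lower m n h′ c′)))
                  (<⇒≢ (upper<lower (oddRow h<m₁) col (oddRow h′<m₁) col′))
  ... | lower h h<m₁ | upper h′ h′<m₁ =
    contradiction (trans (sym (label-upper m n h′ c′)) (trans (sym eq) (label-lower m n h c)))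
                  (<⇒≢ (upper<lower (oddRow h′<m₁) col′ (oddRow h<m₁) col))

  N∸-positive : ∀ {k} → k ≤ m * n → 1 ≤ N ∸ k
  N∸-positive k≤mn = m<n⇒0<n∸m (≤-trans (s≤s k≤mn) mn<N)

  N∸-≤M : ∀ {k} → M < k → N ∸ k ≤ M
  N∸-≤M {k} M<k = subst (N ∸ k ≤_) (trans (cong (_∸ suc M) N≡M+[1+M]) (m+n∸n≡m M (suc M))) (∸-monoʳ-≤ N M<k)

  N∸-involutive : ∀ {k} → k ≤ m * n → N ∸ (N ∸ k) ≡ k
  N∸-involutive k≤mn = m∸[m∸n]≡n (≤-trans k≤mn (m≤m+n (m * n) 1))

  upper-preimage : ∀ {k} → (∃₂ λ i c → OddRow i × Column c × oddLabel i c ≡ k) →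
                   ∃₂ λ r c → IsVertex m n r c × label m n r c ≡ k
  upper-preimage (suc h , c , (_ , h<m₁) , col , x≡k) =
    suc (h * 2) , c , ((s≤s z≤n , ≤-trans (n≤1+n _) (*-monoˡ-≤ 2 h<m₁)) , col) ,
    trans (label-upper m n h c) x≡k

  lower-preimage : ∀ {k} → k ≤ m * n → (∃₂ λ i c → OddRow i × Column c × oddLabel i c ≡ N ∸ k) →
                   ∃₂ λ r c → IsVertex m n r c × label m n r c ≡ k
  lower-preimage k≤mn (suc h , c , (_ , h<m₁) , col , x≡N∸k) =
    suc h * 2 , c , ((s≤s z≤n , *-monoˡ-≤ 2 h<m₁) , col) ,
    trans (label-lower m n h c) (trans (cong (N ∸_) x≡N∸k) (N∸-involutive k≤mn))

  label-surjective : ∀ k → 1 ≤ k → k ≤ m * n → ∃₂ λ r c → IsVertex m n r c × label m n r c ≡ k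
  label-surjective k 1≤k k≤mn with k ≤? M
  ... | yes k≤M  = upper-preimage (oddLabel-surjective 1≤k k≤M)
  ... | no k≰M   = lower-preimage k≤mn (oddLabel-surjective (N∸-positive k≤mn) (N∸-≤M (≰⇒> k≰M)))

  isBijective : IsBijectiveLabeling m n (label m n)
  isBijective = label-range , label-injective , label-surjective

  innerFace-sum-at : ∀ {r c} → RowPosition m₁ r → r < m → Column c → innerFaceSum n (label m n) r c ≡ N + N
  innerFace-sum-at {c = c} (upper h h<m₁) _ col
      rewrite label-upper m n h c | label-upper m n h (next c) | label-lower m n h c | label-lower m n h (next c) =
    pair+complements≡N+N (oddLabel-≤N (oddRow h<m₁) col) (oddLabel-≤N (oddRow h<m₁) (next-column col))
  innerFace-sum-at {c = c} (lower h h<m₁) r<m col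
      rewrite label-lower m n h c | label-lower m n h (next c)
            | label-upper m n (suc h) c | label-upper m n (suc h) (next c) =
    complements+pair≡N+N (oddLabel-≤N (oddRow h<m₁) col) (oddLabel-≤N (oddRow h<m₁) (next-column col))
      (trans (oddLabel-pair (oddRow (*-cancelʳ-< 2 (suc h) m₁ r<m)) (next-opposite col))
             (sym (oddLabel-pair (oddRow h<m₁) (next-opposite col))))

  innerFace-sum : ∀ r c → 1 ≤ r → r < m → 1 ≤ c → c ≤ n → innerFaceSum n (label m n) r c ≡ N + N
  innerFace-sum r c 1≤r r<m 1≤c c≤n = innerFace-sum-at (rowPosition {m₁} 1≤r (<⇒≤ r<m)) r<m (1≤c , c≤n)

  twistFace-sum : ∀ c → 1 ≤ c → c ≤ n → twistFaceSum m n (label m n) c ≡ N + N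
  twistFace-sum c 1≤c c≤n
      rewrite wrap-mirror (1≤c , c≤n) | wrap-n∸ (1≤c , c≤n)
            | label-lower m n m′ c | label-lower m n m′ (next c)
            | label-upper m n 0 (mirror c) | label-upper m n 0 (mirror (next c)) =
    complements+pair≡N+N (oddLabel-≤N lastRow col) (oddLabel-≤N lastRow (next-column col)) (begin
      oddLabel 1 (mirror c) + oddLabel 1 (mirror (next c))
        ≡⟨ oddLabel-pair firstRow (mirror-opposite (next-opposite col)) ⟩
      m * (block (mirror c) + block (mirror (next c))) + suc m
        ≡⟨ cong₂ (λ b b′ → m * (b + b′) + suc m) (block-mirror col) (block-mirror (next-column col)) ⟩
      m * (block c + block (next c)) + suc m
        ≡⟨ sym (oddLabel-pair lastRow (next-opposite col)) ⟩
      oddLabel m₁ c + oddLabel m₁ (next c)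
        ∎)
    where
    open ≡-Reasoning
    col : Column c
    col = 1≤c , c≤n
    firstRow : OddRow 1
    firstRow = ≤-refl , s≤s z≤n
    lastRow : OddRow m₁
    lastRow = oddRow ≤-refl

  isFaceMagic : IsC4FaceMagicKleinLabeling m n (label m n)
  isFaceMagic = isBijective , N + N , innerFace-sum , twistFace-sum

proposition3p5 : (m n : ℕ) → 0 < m → 0 < n → 2 ∣ m → 2 ∣ n →
    IsC4FaceMagicKleinLabeling m n (label m n)
proposition3p5 .(zero * 2) .(n₁ * 2) () _ (divides zero refl) (divides n₁ refl)
proposition3p5 .(suc m′ * 2) .(n₁ * 2) _ _ (divides (suc m′) refl) (divides n₁ refl) =
  Construction.isFaceMagic m′ n₁
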